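{- If $A\subset\mathbb{F}_5^2$ is sum-free and $|A|\ge 5$, then there exists a $1$-dimensional subspace $V<\mathbb{F}_5^2$ such that $(A+A)\cup(A-A)$ contains two distinct cosets of $V$.
   Context: A set $A$ is sum-free if there are no $a,b,c\in A$ with $a+b=c$. -}

module Defs where

open import Data.Nat as ℕ using (ℕ)
open import Data.Nat.DivMod using (_mod_)
open import Data.Fin using (Fin; toℕ; zero)
open import Data.Product using (_×_; _,_; ∃; ∃-syntax)
open import Data.Sum using (_⊎_)
open import Data.Bool using (Bool; true)
open import Data.List using (List; filter; length; cartesianProduct; allFin)
open import Relation.Nullary using (¬_)
open import Relation.Binary.PropositionalEquality using (_≡_)
import Data.Bool.Properties as BP

𝔽₅ : Set
𝔽₅ = Fin 5

_+₅_ : 𝔽₅ → 𝔽₅ → 𝔽₅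
x +₅ y = (toℕ x ℕ.+ toℕ y) mod 5

-₅_ : 𝔽₅ → 𝔽₅
-₅ x = (5 ℕ.∸ toℕ x) mod 5

_*₅_ : 𝔽₅ → 𝔽₅ → 𝔽₅
x *₅ y = (toℕ x ℕ.* toℕ y) mod 5

V2 : Set
V2 = 𝔽₅ × 𝔽₅

0v : V2
0v = (zero , zero)

_⊕_ : V2 → V2 → V2
(a , b) ⊕ (c , d) = (a +₅ c , b +₅ d)

⊖_ : V2 → V2
⊖ (a , b) = (-₅ a , -₅ b)

_⊝_ : V2 → V2 → V2
u ⊝ v = u ⊕ (⊖ v)

_·_ : 𝔽₅ → V2 → V2
t · (a , b) = (t *₅ a , t *₅ b)

Subset² : Set
Subset² = V2 → Bool

_∈_ : V2 → Subset² → Set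
x ∈ A = A x ≡ true

allV2 : List V2
allV2 = cartesianProduct (allFin 5) (allFin 5)

card : Subset² → ℕ
card A = length (filter (λ x → A x BP.≟ true) allV2)

SumFree : Subset² → Set
SumFree A = ∀ a b c → a ∈ A → b ∈ A → c ∈ A → ¬ (a ⊕ b ≡ c)

SumDiff : Subset² → V2 → Set
SumDiff A z = ∃[ a ] ∃[ b ] (a ∈ A × b ∈ A × (z ≡ a ⊕ b ⊎ z ≡ a ⊝ b))

-- The 1-dimensional subspace spanned by a nonzero vector v: V = { t·v }.
-- (Every 1-dimensional subspace of 𝔽₅² is of this form.)
Span : V2 → V2 → Set
Span v w = ∃[ t ] (w ≡ t · v)

CosetIn : V2 → V2 → (V2 → Set) → Set
CosetIn v x S = ∀ w → Span v w → S (x ⊕ w)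

DistinctCosets : V2 → V2 → V2 → Set
DistinctCosets v x y = ¬ Span v (x ⊝ y)

-- Both the hypothesis and the conclusion are monotone in A: subsets of a sum-free set are
-- sum-free, and (A + A) ∪ (A − A) only grows with A.  So it suffices to treat the 3384
-- sum-free 5-element subsets of 𝔽₅², which a search over ordered lists (pruning prefixes
-- that are not sum-free) enumerates completely.  For each of them, evaluation finds one of
-- the six lines through 0 and two of its cosets lying in (A + A) ∪ (A − A).
module Submission where

open import Defs
open import Data.Nat as ℕ using (ℕ; zero; suc; _≥_)
open import Data.Fin.Patterns using (0F; 1F)
import Data.Fin.Properties as Fin
open import Data.Product using (_×_; _,_; ∃-syntax; uncurry)
open import Data.Product.Properties using (,-injective)
open import Data.Bool using (Bool; true; false; T; if_then_else_)
import Data.Bool.Properties as Bool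
open import Data.Empty using (⊥-elim)
open import Data.Sum using (_⊎_; inj₁; inj₂)
open import Data.List using (List; []; _∷_; _++_; foldr; concatMap; cartesianProduct; filter; length; allFin; map)
open import Data.List.Relation.Unary.All as All using (All; _∷_)
open import Data.List.Relation.Unary.Any as Any using (Any; here; there)
open import Data.List.Membership.Propositional using (find) renaming (_∈_ to _∈ₗ_; _∉_ to _∉ₗ_)
open import Data.List.Membership.Propositional.Properties
  using (∈-concatMap⁻; ∈-cartesianProduct⁻; ∈-++⁺ˡ; ∈-++⁺ʳ)
open import Data.Vec using (Vec; lookup; updateAt; replicate)
open import Data.Vec.Properties using (lookup∘updateAt; lookup∘updateAt′; lookup-replicate)
open import Function using (_∘_)
open import Relation.Nullary using (¬_; Dec; yes; no; does; proof; ¬?; _×-dec_)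
open import Relation.Nullary.Decidable using (map′; dec-true)
open import Relation.Nullary.Reflects using (Reflects; invert)
open import Relation.Unary using (Pred; Decidable; _⊆_)
open import Relation.Binary using (DecidableEquality)
open import Relation.Binary.PropositionalEquality using (_≡_; refl; subst; sym; trans; cong; cong₂)

_≟_ : DecidableEquality V2
(a , b) ≟ (c , d) = map′ (uncurry (cong₂ _,_)) ,-injective (a Fin.≟ c ×-dec b Fin.≟ d)

open import Data.List.Membership.DecPropositional _≟_ using (_∈?_)

TwoCosets : Pred V2 _ → Set
TwoCosets S = ∃[ v ] (¬ (v ≡ 0v) × ∃[ x ] ∃[ y ]
  (DistinctCosets v x y × CosetIn v x S × CosetIn v y S))

TwoCosets-mono : ∀ {S S′} → S ⊆ S′ → TwoCosets S → TwoCosets S′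
TwoCosets-mono S⊆S′ (v , v≢0 , x , y , x≁y , x+V⊆S , y+V⊆S) =
  v , v≢0 , x , y , x≁y , (λ w w∈V → S⊆S′ (x+V⊆S w w∈V)) , (λ w w∈V → S⊆S′ (y+V⊆S w w∈V))

cosetIn? : ∀ {S : Pred V2 _} → Decidable S → ∀ v x → Dec (CosetIn v x S)
cosetIn? {S} S? v x =
  map′ (λ covers w (t , w≡tv) → subst (λ w → S (x ⊕ w)) (sym w≡tv) (covers t))
       (λ x+V⊆S t → x+V⊆S (t · v) (t , refl))
       (Fin.all? λ t → S? (x ⊕ (t · v)))

distinctCosets? : ∀ v x y → Dec (DistinctCosets v x y)
distinctCosets? v x y = ¬? (Fin.any? λ t → (x ⊝ y) ≟ (t · v))

Candidate : Set
Candidate = V2 × V2 × V2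

Witness : Pred V2 _ → Candidate → Set
Witness S (v , x , y) = (CosetIn v x S × CosetIn v y S) × ¬ (v ≡ 0v) × DistinctCosets v x y

witness? : ∀ {S} → Decidable S → Decidable (Witness S)
witness? S? (v , x , y) =
  (cosetIn? S? v x ×-dec cosetIn? S? v y) ×-dec ¬? (v ≟ 0v) ×-dec distinctCosets? v x y

Witness⇒TwoCosets : ∀ S c → Witness S c → TwoCosets S
Witness⇒TwoCosets S (v , x , y) ((x+V⊆S , y+V⊆S) , v≢0 , x≁y) = v , v≢0 , x , y , x≁y , x+V⊆S , y+V⊆S

-- A spanning vector of each of the six lines through 0, with a transversal of its cosets.
directions : List (V2 × (𝔽₅ → V2))
directions = ((0F , 1F) , λ j → j , 0F) ∷ map (λ s → (1F , s) , λ j → 0F , j) (allFin 5)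

candidates : List Candidate
candidates = concatMap (λ (v , rep) → map (λ (i , j) → v , rep i , rep j) pairs) directions
  where pairs = filter (λ (i , j) → i Fin.<? j) (cartesianProduct (allFin 5) (allFin 5))

-- Membership in a finite set of vectors, tabulated so that the final evaluation builds it once
-- per set and then answers each query by two lookups.
Table : Set
Table = Vec (Vec Bool 5) 5

_‼_ : Table → V2 → Bool
t ‼ (a , b) = lookup (lookup t a) b

InTable : Table → Pred V2 _
InTable t z = T (t ‼ z)

insert : V2 → Table → Table
insert (a , b) t = updateAt t a (λ row → updateAt row b (λ _ → true))

tableOf : List V2 → Table
tableOf = foldr insert (replicate 5 (replicate 5 false))

tableOf-sound : ∀ L → InTable (tableOf L) ⊆ (_∈ₗ L)
tableOf-sound [] {c , d} z∈
  rewrite lookup-replicate c (replicate 5 false) | lookup-replicate d false = ⊥-elim z∈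
tableOf-sound ((a , b) ∷ L) {c , d} z∈ with c Fin.≟ a | d Fin.≟ b
... | yes refl | yes refl = here refl
... | no c≢a   | _        = there (tableOf-sound L
  (subst T (cong (λ row → lookup row d) (lookup∘updateAt′ c a c≢a (tableOf L))) z∈))
... | yes refl | no d≢b   = there (tableOf-sound L
  (subst T (trans (cong (λ row → lookup row d) (lookup∘updateAt c (tableOf L)))
                  (lookup∘updateAt′ d b d≢b (lookup (tableOf L) c))) z∈))

candidateWitness? : ∀ t → Dec (Any (Witness (InTable t)) candidates)
candidateWitness? t = Any.any? (witness? (Bool.T? ∘ (t ‼_))) candidates

sumsAndDiffs : List V2 → List V2
sumsAndDiffs L = concatMap (λ (a , b) → a ⊕ b ∷ a ⊝ b ∷ []) (cartesianProduct L L)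

HasCandidateWitness : List V2 → Set
HasCandidateWitness L = Any (Witness (InTable (tableOf (sumsAndDiffs L)))) candidates

SumFreeList : List V2 → Set
SumFreeList L = All (λ a → All (λ b → a ⊕ b ∉ₗ L) L) L

sumFreeList? : (L : List V2) → Dec (SumFreeList L)
sumFreeList? L = All.all? (λ a → All.all? (λ b → ¬? ((a ⊕ b) ∈? L)) L) L

sumFreeExtensions : ℕ → List V2 → List V2 → List (List V2)
sumFreeExtensions zero    c r       = c ∷ []
sumFreeExtensions (suc k) c []      = []
sumFreeExtensions (suc k) c (x ∷ r) =
  (if does (sumFreeList? (x ∷ c)) then sumFreeExtensions k (x ∷ c) r else [])
  ++ sumFreeExtensions (suc k) c r

-- Opaque, so that later type checking never unfolds this proof and re-runs the evaluation.
opaque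
  sumFreeExtensions-witnessed : All HasCandidateWitness (sumFreeExtensions 5 [] allV2)
  sumFreeExtensions-witnessed = invert (subst (Reflects _) evaluated (proof all-witnessed?))
    where
      all-witnessed? : Dec (All HasCandidateWitness (sumFreeExtensions 5 [] allV2))
      all-witnessed? = All.all? (candidateWitness? ∘ tableOf ∘ sumsAndDiffs) (sumFreeExtensions 5 [] allV2)
      evaluated : does all-witnessed? ≡ true
      evaluated = refl

∈-if⁺ : ∀ {A : Set} {b} {x : A} {xs} → b ≡ true → x ∈ₗ xs → x ∈ₗ (if b then xs else [])
∈-if⁺ refl x∈ = x∈

count : Subset² → List V2 → ℕ
count A r = length (filter (λ x → A x Bool.≟ true) r)

module _ {A : Subset²} where

  sumsAndDiffs⊆SumDiff : ∀ {L} → All (_∈ A) L → (_∈ₗ sumsAndDiffs L) ⊆ SumDiff A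
  sumsAndDiffs⊆SumDiff {L} L⊆A z∈
    with (a , b) , ab∈ , z∈ab ← find (∈-concatMap⁻ _ {xs = cartesianProduct L L} z∈)
    with a∈ , b∈ ← ∈-cartesianProduct⁻ L L ab∈
    = a , b , All.lookup L⊆A a∈ , All.lookup L⊆A b∈ , sumOrDiff z∈ab
    where
      sumOrDiff : ∀ {z} → z ∈ₗ a ⊕ b ∷ a ⊝ b ∷ [] → z ≡ a ⊕ b ⊎ z ≡ a ⊝ b
      sumOrDiff (here z≡)         = inj₁ z≡
      sumOrDiff (there (here z≡)) = inj₂ z≡

  SumFree⇒SumFreeList : SumFree A → ∀ {L} → All (_∈ A) L → SumFreeList L
  SumFree⇒SumFreeList sfA L⊆A = All.tabulate λ a∈ → All.tabulate λ b∈ a+b∈ →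
    sfA _ _ _ (All.lookup L⊆A a∈) (All.lookup L⊆A b∈) (All.lookup L⊆A a+b∈) refl

  sumFreeExtensions-complete : SumFree A → ∀ k c r → All (_∈ A) c → count A r ≥ k →
                               ∃[ L ] (L ∈ₗ sumFreeExtensions k c r × All (_∈ A) L)
  sumFreeExtensions-complete sfA zero c r c⊆A _ = c , here refl , c⊆A
  sumFreeExtensions-complete sfA (suc k) c (x ∷ r) c⊆A k≤ with A x in x∈A
  ... | true =
    let L , L∈ , L⊆A = sumFreeExtensions-complete sfA k (x ∷ c) r (x∈A ∷ c⊆A) (ℕ.s≤s⁻¹ k≤)
        x∷c-sumFree  = dec-true (sumFreeList? (x ∷ c)) (SumFree⇒SumFreeList sfA (x∈A ∷ c⊆A))
    in  L , ∈-++⁺ˡ (∈-if⁺ x∷c-sumFree L∈) , L⊆A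
  ... | false =
    let L , L∈ , L⊆A = sumFreeExtensions-complete sfA (suc k) c r c⊆A k≤
    in  L , ∈-++⁺ʳ _ L∈ , L⊆A

lemma3p2 : (A : Subset²) → SumFree A → card A ≥ 5 →
    ∃[ v ] (¬ (v ≡ 0v) × ∃[ x ] ∃[ y ]
      (DistinctCosets v x y × CosetIn v x (SumDiff A) × CosetIn v y (SumDiff A)))
lemma3p2 A sfA |A|≥5 =
  let L , L∈ , L⊆A = sumFreeExtensions-complete sfA 5 [] allV2 All.[] |A|≥5
      S            = InTable (tableOf (sumsAndDiffs L))
      c , witness  = Any.satisfied (All.lookup sumFreeExtensions-witnessed L∈)
  in  TwoCosets-mono {S} (sumsAndDiffs⊆SumDiff L⊆A ∘ tableOf-sound (sumsAndDiffs L))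
                         (Witness⇒TwoCosets S c witness)
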